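{- Let $n$ be a positive integer, $m=\binom{n}{2}$, $M=\lceil m/2\rceil$, and let $\mathcal{G}^{(j)}$ be the set of connected graphs on vertex set $[n]$ with exactly $j$ edges. For every $k=M+n,\dots,m$ there is a complete matching from $\mathcal{G}^{(k+1)}$ to $\mathcal{G}^{(k)}$.
   Context: Graphs are simple; $\mathcal{G}^{(m+1)}=\emptyset$. A complete matching from $\mathcal{G}^{(k)}$ to $\mathcal{G}^{(l)}$ is an injection $f:\mathcal{G}^{(k)}\to\mathcal{G}^{(l)}$ such that $G$ and $f(G)$ are comparable (one edge set contains the other) for every $G\in\mathcal{G}^{(k)}$. -}

module Defs where

open import Data.Nat using (ℕ; zero; suc; _+_)
open import Data.Nat.ListAction using (sum)
open import Data.Bool using (Bool; true; false; _∧_; if_then_else_)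
open import Data.Fin using (Fin; _<?_)
open import Data.List using (map; allFin)
open import Data.Product using (Σ; _×_; proj₁)
open import Data.Sum using (_⊎_)
open import Relation.Nullary.Decidable using (⌊_⌋)
open import Relation.Binary.PropositionalEquality using (_≡_)

Graph : ℕ → Set
Graph n = Fin n → Fin n → Bool

IsSimple : ∀ {n} → Graph n → Set
IsSimple {n} G = (∀ (i j : Fin n) → G i j ≡ G j i) × (∀ (i : Fin n) → G i i ≡ false)

edgeCount : ∀ {n} → Graph n → ℕ
edgeCount {n} G =
  sum (map (λ i → sum (map (λ j → if ⌊ i <? j ⌋ ∧ G i j then 1 else 0) (allFin n))) (allFin n))

data Walk {n : ℕ} (G : Graph n) : Fin n → Fin n → Set where
  here : ∀ {i} → Walk G i i
  step : ∀ {i k j} → G i k ≡ true → Walk G k j → Walk G i j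

Connected : ∀ {n} → Graph n → Set
Connected {n} G = ∀ (i j : Fin n) → Walk G i j

ConnGraphs : ℕ → ℕ → Set
ConnGraphs n j = Σ (Graph n) λ G → IsSimple G × Connected G × edgeCount G ≡ j

_≈G_ : ∀ {n} → Graph n → Graph n → Set
_≈G_ {n} G H = ∀ (i j : Fin n) → G i j ≡ H i j

_⊆G_ : ∀ {n} → Graph n → Graph n → Set
_⊆G_ {n} G H = ∀ (i j : Fin n) → G i j ≡ true → H i j ≡ true

Comparable : ∀ {n} → Graph n → Graph n → Set
Comparable G H = G ⊆G H ⊎ H ⊆G G

-- A complete matching from 𝒢^(k) to 𝒢^(l): a (well-defined) injective map f
-- with G and f(G) comparable for every G.
CompleteMatching : (n k l : ℕ) → Set
CompleteMatching n k l =
  Σ (ConnGraphs n k → ConnGraphs n l) λ f →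
      (∀ G H → proj₁ G ≈G proj₁ H → proj₁ (f G) ≈G proj₁ (f H))
    × (∀ G H → proj₁ (f G) ≈G proj₁ (f H) → proj₁ G ≈G proj₁ H)
    × (∀ G → Comparable (proj₁ G) (proj₁ (f G)))

module Submission where

-- A graph is stored as its code: the m slots {i < j} of Kₙ in a fixed order, each with a
-- presence bit; decoding inverts encoding on simple graphs and the edge count is the weight
-- of the code.  Scanning the code, Kruskal's algorithm marks a spanning forest of at most n
-- edges, and deleting non-forest edges does not change its outcome.  The non-forest slots
-- are read as a bracket word (absent edge = opening, present edge = closing bracket): `lower`
-- deletes the last unmatched present edge and `raise` restores it, as in the Greene–Kleitman
-- symmetric chain matching.  With k + 1 edges more than half of the non-forest slots carry
-- edges, so an unmatched one exists.  Hence down G ⊆ G has k edges, keeps the forest and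
-- so stays connected, and G is recovered from down G by rerunning Kruskal and raising.

open import Defs
open import Data.Bool using (Bool; true; false; not; _∨_; _∧_; if_then_else_)
open import Data.Bool.Properties using (∨-comm)
open import Data.Empty using (⊥; ⊥-elim)
open import Data.Fin using (Fin; zero; suc; toℕ; _<?_)
open import Data.Fin.Properties using (_≟_; toℕ-injective) renaming (suc-injective to Fin-suc-injective)
open import Data.List using (List; []; _∷_; map; allFin; _++_; length)
open import Data.List.Membership.Propositional using (_∈_)
open import Data.List.Membership.Propositional.Properties using (∈-map⁺; ∈-map⁻; ∈-++⁺ˡ; ∈-++⁺ʳ; ∈-++⁻; ∈-allFin)
open import Data.List.Properties
  using (map-tabulate; length-map; length-++; length-tabulate; map-∘; map-id; map-id-local; map-cong-local; map-cong; map-++)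
open import Data.List.Relation.Binary.Pointwise using (Pointwise; []; _∷_)
open import Data.List.Relation.Unary.All as All using (All; []; _∷_)
open import Data.List.Relation.Unary.All.Properties using (map⁻)
open import Data.List.Relation.Unary.AllPairs using (AllPairs; []; _∷_)
open import Data.List.Relation.Unary.Any using (here; there)
open import Data.List.Relation.Unary.Unique.Propositional using (Unique)
import Data.List.Relation.Unary.Unique.Propositional.Properties as Unique
open import Data.Nat using (ℕ; zero; suc; _+_; _≤_; _<_; z≤n; s≤s; ⌈_/2⌉)
open import Data.Nat.Combinatorics using (_C_; nC1≡n; nCk+nC[k+1]≡[n+1]C[k+1])
open import Data.Nat.ListAction using (sum)
open import Data.Nat.ListAction.Properties using (sum-++)
open import Data.Nat.Properties
  using (<-asym; <-irrefl; <-cmp; ≤-pred; ≤-trans; ≤-reflexive; n≤1+n; +-suc; +-assoc; +-mono-≤; +-monoˡ-≤;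
         n<1+n; +-mono-<; <⇒≱; m≤m+n; suc-injective; ⌊n/2⌋+⌈n/2⌉≡n; ⌊n/2⌋≤⌈n/2⌉; module ≤-Reasoning)
open import Data.Nat.Tactic.RingSolver using (solve-∀)
open import Data.Product using (_×_; _,_; proj₁; proj₂; swap)
open import Data.Product.Properties using (≡-dec)
open import Data.Sum using (_⊎_; inj₁; inj₂)
open import Function using (_∘_; id)
open import Relation.Binary.Definitions using (DecidableEquality; tri<; tri≈; tri>)
open import Relation.Binary.PropositionalEquality
open import Relation.Nullary using (Dec; yes; no; ¬_)
open import Relation.Nullary.Decidable using (⌊_⌋; dec-true; dec-false; isYes≗does)

bit : Bool → ℕ
bit b = if b then 1 else 0

count : ∀ {A : Set} → (A → Bool) → List A → ℕ
count f xs = sum (map (bit ∘ f) xs)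

count≤length : ∀ {A : Set} (f : A → Bool) (xs : List A) → count f xs ≤ length xs
count≤length f [] = z≤n
count≤length f (x ∷ xs) with f x
... | true  = s≤s (count≤length f xs)
... | false = ≤-trans (count≤length f xs) (n≤1+n _)

count-mono : ∀ {A : Set} {f g : A → Bool} → (∀ x → f x ≡ true → g x ≡ true) →
             (xs : List A) → count f xs ≤ count g xs
count-mono f⇒g [] = z≤n
count-mono {f = f} {g} f⇒g (x ∷ xs) with f x in fx | g x in gx
... | true  | true  = s≤s (count-mono f⇒g xs)
... | true  | false with () ← trans (sym gx) (f⇒g x fx)
... | false | true  = ≤-trans (count-mono f⇒g xs) (n≤1+n _)
... | false | false = count-mono f⇒g xs

count-strict : ∀ {A : Set} {f g : A → Bool} → (∀ x → f x ≡ true → g x ≡ true) →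
               ∀ {r} {xs : List A} → r ∈ xs → f r ≡ false → g r ≡ true → count f xs < count g xs
count-strict f⇒g {xs = x ∷ xs} (here refl) fr gr rewrite fr | gr = s≤s (count-mono f⇒g xs)
count-strict {f = f} {g} f⇒g {xs = x ∷ xs} (there r∈) fr gr with f x in fx | g x in gx
... | true  | true  = s≤s (count-strict f⇒g r∈ fr gr)
... | true  | false with () ← trans (sym gx) (f⇒g x fx)
... | false | true  = ≤-trans (count-strict f⇒g r∈ fr gr) (n≤1+n _)
... | false | false = count-strict f⇒g r∈ fr gr

⌊⌋-true : ∀ {P : Set} (d : Dec P) → P → ⌊ d ⌋ ≡ true
⌊⌋-true d p = trans (isYes≗does d) (dec-true d p)

⌊⌋-false : ∀ {P : Set} (d : Dec P) → ¬ P → ⌊ d ⌋ ≡ false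
⌊⌋-false d ¬p = trans (isYes≗does d) (dec-false d ¬p)

⌊⌋-sound : ∀ {P : Set} (d : Dec P) → ⌊ d ⌋ ≡ true → P
⌊⌋-sound (yes p) _ = p

_▸_ : ∀ {n} {G : Graph n} {x y z} → Walk G x y → Walk G y z → Walk G x z
here ▸ w = w
step e v ▸ w = step e (v ▸ w)

walk-mono : ∀ {n} {G H : Graph n} → G ⊆G H → ∀ {x y} → Walk G x y → Walk H x y
walk-mono G⊆H here = here
walk-mono G⊆H (step e w) = step (G⊆H _ _ e) (walk-mono G⊆H w)

map-allFin-suc : ∀ {A : Set} {n} (f : Fin (suc n) → A) →
                 map f (allFin (suc n)) ≡ f zero ∷ map (f ∘ suc) (allFin n)
map-allFin-suc f = cong (f zero ∷_) (trans (map-tabulate suc f) (sym (map-tabulate id (f ∘ suc))))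

Pair : ℕ → Set
Pair n = Fin n × Fin n

Ordered : ∀ {n} → Pair n → Set
Ordered (i , j) = toℕ i < toℕ j

shift : ∀ {n} → Pair n → Pair (suc n)
shift (i , j) = suc i , suc j

slots : (n : ℕ) → List (Pair n)
slots zero = []
slots (suc n) = map (λ j → zero , suc j) (allFin n) ++ map shift (slots n)

slots-complete : ∀ {n} {i j : Fin n} → Ordered (i , j) → (i , j) ∈ slots n
slots-complete {suc n} {zero} {suc j} _ = ∈-++⁺ˡ (∈-map⁺ _ (∈-allFin j))
slots-complete {suc n} {suc i} {suc j} (s≤s i<j) =
  ∈-++⁺ʳ (map _ (allFin n)) (∈-map⁺ shift (slots-complete i<j))

slots-ordered : ∀ {n} {p : Pair n} → p ∈ slots n → Ordered p
slots-ordered {suc n} p∈ with ∈-++⁻ (map _ (allFin n)) p∈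
... | inj₁ p∈ˡ with ∈-map⁻ _ p∈ˡ
...   | _ , _ , refl = s≤s z≤n
slots-ordered {suc n} p∈ | inj₂ p∈ʳ with ∈-map⁻ shift p∈ʳ
...   | _ , q∈ , refl = s≤s (slots-ordered q∈)

slots-suffice : ∀ {n} {R : Fin n → Fin n → Set} → (∀ {i j} → R i j → R j i) → (∀ i → R i i) →
                (∀ {p} → p ∈ slots n → R (proj₁ p) (proj₂ p)) → ∀ i j → R i j
slots-suffice R-sym R-refl R-slots i j with <-cmp (toℕ i) (toℕ j)
... | tri< i<j _ _ = R-slots (slots-complete i<j)
... | tri> _ _ j<i = R-sym (R-slots (slots-complete j<i))
... | tri≈ _ i≡j _ with refl ← toℕ-injective i≡j = R-refl i

slots-unique : ∀ n → Unique (slots n)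
slots-unique zero = []
slots-unique (suc n) =
  Unique.++⁺ (Unique.map⁺ (Fin-suc-injective ∘ cong proj₂) (Unique.allFin⁺ n))
             (Unique.map⁺ shift-injective (slots-unique n))
             apart
  where
  shift-injective : ∀ {p q : Pair n} → shift p ≡ shift q → p ≡ q
  shift-injective refl = refl
  apart : ∀ {p} → ¬ (p ∈ map _ (allFin n) × p ∈ map shift (slots n))
  apart (p∈ˡ , p∈ʳ) with ∈-map⁻ _ p∈ˡ | ∈-map⁻ shift p∈ʳ
  ... | _ , _ , refl | _ , _ , ()

length-slots : ∀ n → length (slots n) ≡ n C 2
length-slots zero = refl
length-slots (suc n) = begin
  length (map _ (allFin n) ++ map shift (slots n))
    ≡⟨ length-++ (map _ (allFin n)) ⟩
  length (map _ (allFin n)) + length (map shift (slots n))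
    ≡⟨ cong₂ _+_ (trans (length-map _ (allFin n)) (length-tabulate id))
                 (trans (length-map shift (slots n)) (length-slots n)) ⟩
  n + n C 2
    ≡⟨ cong (_+ n C 2) (sym (nC1≡n n)) ⟩
  n C 1 + n C 2
    ≡⟨ nCk+nC[k+1]≡[n+1]C[k+1] n 1 ⟩
  suc n C 2 ∎
  where open ≡-Reasoning

_≟ₚ_ : ∀ {n} → DecidableEquality (Pair n)
_≟ₚ_ = ≡-dec _≟_ _≟_

sameEdge : ∀ {n} → Pair n → Pair n → Bool
sameEdge q p = ⌊ q ≟ₚ p ⌋ ∨ ⌊ swap q ≟ₚ p ⌋

sameEdge-refl : ∀ {n} (p : Pair n) → sameEdge p p ≡ true
sameEdge-refl p with p ≟ₚ p
... | yes _   = refl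
... | no p≢p = ⊥-elim (p≢p refl)

sameEdge-swap : ∀ {n} (q p : Pair n) → sameEdge q p ≡ sameEdge (swap q) p
sameEdge-swap q p = ∨-comm ⌊ q ≟ₚ p ⌋ ⌊ swap q ≟ₚ p ⌋

sameEdge-true : ∀ {n} {q p : Pair n} → sameEdge q p ≡ true → q ≡ p ⊎ swap q ≡ p
sameEdge-true {q = q} {p} eq with q ≟ₚ p | swap q ≟ₚ p
... | yes q≡p | _       = inj₁ q≡p
... | no _    | yes q≡p = inj₂ q≡p

-- A later key q does not denote the same edge as the earlier key p.
Apart : ∀ {n} → Pair n → Pair n → Set
Apart p q = sameEdge q p ≡ false

apart : ∀ {n} {p q : Pair n} → Ordered p → Ordered q → p ≢ q → Apart p q
apart {p = p} {q} op oq p≢q with q ≟ₚ p | swap q ≟ₚ p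
... | yes q≡p | _    = ⊥-elim (p≢q (sym q≡p))
... | no _    | yes refl = ⊥-elim (<-asym oq op)
... | no _    | no _ = refl

apart-ordered : ∀ {n} {ps : List (Pair n)} → Unique ps → All Ordered ps → AllPairs Apart ps
apart-ordered [] [] = []
apart-ordered (p≢ ∷ u) (op ∷ ops) =
  All.zipWith (λ (p≢q , oq) → apart op oq p≢q) (p≢ , ops) ∷ apart-ordered u ops

slots-apart : ∀ n → AllPairs Apart (slots n)
slots-apart n = apart-ordered (slots-unique n) (All.tabulate slots-ordered)

Code : ℕ → Set
Code n = List (Pair n × Bool)

keys : ∀ {n} → Code n → List (Pair n)
keys = map proj₁

weight : ∀ {n} → Code n → ℕ
weight z = count proj₂ z

adj : ∀ {n} → Graph n → Pair n → Bool
adj G (i , j) = G i j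

encode : ∀ {n} → Graph n → Code n
encode {n} G = map (λ p → p , adj G p) (slots n)

decode : ∀ {n} → Code n → Graph n
decode [] i j = false
decode ((p , b) ∷ z) i j = if sameEdge (i , j) p then b else decode z i j

keys-encode : ∀ {n} (G : Graph n) → keys (encode G) ≡ slots n
keys-encode {n} G = trans (sym (map-∘ (slots n))) (map-id (slots n))

decode-symmetric : ∀ {n} (z : Code n) (i j : Fin n) → decode z i j ≡ decode z j i
decode-symmetric [] i j = refl
decode-symmetric ((p , b) ∷ z) i j
  rewrite sameEdge-swap (i , j) p | decode-symmetric z i j = refl

decode-loopless : ∀ {n} (z : Code n) → All Ordered (keys z) → (i : Fin n) → decode z i i ≡ false
decode-loopless [] _ i = refl
decode-loopless ((p , b) ∷ z) (op ∷ ops) i with sameEdge (i , i) p in eq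
... | false = decode-loopless z ops i
... | true with sameEdge-true {q = i , i} {p} eq
...   | inj₁ refl = ⊥-elim (<-irrefl refl op)
...   | inj₂ refl = ⊥-elim (<-irrefl refl op)

decode-lookup : ∀ {n} (z : Code n) → AllPairs Apart (keys z) → All (λ e → adj (decode z) (proj₁ e) ≡ proj₂ e) z
decode-lookup [] [] = []
decode-lookup ((p , b) ∷ z) (apart-p ∷ apart-z) =
  head ∷ All.zipWith later (map⁻ apart-p , decode-lookup z apart-z)
  where
  head : (if sameEdge p p then b else adj (decode z) p) ≡ b
  head rewrite sameEdge-refl p = refl
  later : ∀ {e} → Apart p (proj₁ e) × adj (decode z) (proj₁ e) ≡ proj₂ e →
          adj (decode ((p , b) ∷ z)) (proj₁ e) ≡ proj₂ e
  later (p-apart , looked-up) rewrite p-apart = looked-up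

ordered-keys : ∀ {n} {z : Code n} → keys z ≡ slots n → All Ordered (keys z)
ordered-keys keys≡ = subst (All Ordered) (sym keys≡) (All.tabulate slots-ordered)

apart-keys : ∀ {n} {z : Code n} → keys z ≡ slots n → AllPairs Apart (keys z)
apart-keys {n} keys≡ = subst (AllPairs Apart) (sym keys≡) (slots-apart n)

encode-decode : ∀ {n} (z : Code n) → keys z ≡ slots n → encode (decode z) ≡ z
encode-decode {n} z keys≡ = begin
  map (λ p → p , adj (decode z) p) (slots n)       ≡⟨ cong (map _) (sym keys≡) ⟩
  map (λ p → p , adj (decode z) p) (map proj₁ z)   ≡⟨ sym (map-∘ z) ⟩
  map (λ e → proj₁ e , adj (decode z) (proj₁ e)) z ≡⟨ map-id-local (All.map (λ {e} → cong (proj₁ e ,_)) looked-up) ⟩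
  z                                                ∎
  where
  open ≡-Reasoning
  looked-up : All (λ e → adj (decode z) (proj₁ e) ≡ proj₂ e) z
  looked-up = decode-lookup z (apart-keys keys≡)

decode-simple : ∀ {n} (z : Code n) → keys z ≡ slots n → IsSimple (decode z)
decode-simple z keys≡ = decode-symmetric z , decode-loopless z (ordered-keys keys≡)

encode-lookup : ∀ {n} (G : Graph n) {p : Pair n} → p ∈ slots n → adj (decode (encode G)) p ≡ adj G p
encode-lookup G = All.lookup (map⁻ (decode-lookup (encode G) (apart-keys (keys-encode G))))

decode-encode : ∀ {n} (G : Graph n) → IsSimple G → G ≈G decode (encode G)
decode-encode G (G-sym , G-loopless) = slots-suffice
  (λ {i} {j} Gij≡ → trans (sym (G-sym i j)) (trans Gij≡ (decode-symmetric (encode G) i j)))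
  (λ i → trans (G-loopless i) (sym (decode-loopless (encode G) (ordered-keys (keys-encode G)) i)))
  (λ p∈ → sym (encode-lookup G p∈))

_⊑_ : ∀ {n} → Pair n × Bool → Pair n × Bool → Set
(p , b) ⊑ (q , c) = p ≡ q × (b ≡ true → c ≡ true)

decode-mono : ∀ {n} {z z' : Code n} → Pointwise _⊑_ z z' → decode z ⊆G decode z'
decode-mono [] i j edge = edge
decode-mono {z = (p , b) ∷ _} ((refl , b⇒c) ∷ z⊑z') i j edge with sameEdge (i , j) p
... | true  = b⇒c edge
... | false = decode-mono z⊑z' i j edge

<?-suc : ∀ {n} (i j : Fin n) → ⌊ suc i <? suc j ⌋ ≡ ⌊ i <? j ⌋
<?-suc i j with i <? j | suc i <? suc j
... | yes _   | yes _     = refl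
... | no _    | no _      = refl
... | yes i<j | no si≮sj  = ⊥-elim (si≮sj (s≤s i<j))
... | no i≮j  | yes si<sj = ⊥-elim (i≮j (≤-pred si<sj))

rowCount : ∀ {n} → Graph n → Fin n → ℕ
rowCount {n} G i = sum (map (λ j → if ⌊ i <? j ⌋ ∧ G i j then 1 else 0) (allFin n))

edgeCount-slots : ∀ {n} (G : Graph n) → edgeCount G ≡ count (adj G) (slots n)
edgeCount-slots {zero} G = refl
edgeCount-slots {suc n} G = begin
  sum (map (rowCount G) (allFin (suc n)))
    ≡⟨ cong sum (map-allFin-suc (rowCount G)) ⟩
  rowCount G zero + sum (map (rowCount G ∘ suc) (allFin n))
    ≡⟨ cong₂ _+_ first-row (cong sum (map-cong-local {xs = allFin n} (All.tabulate (λ {i} _ → later-row i)))) ⟩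
  sum (map (bit ∘ adj G) first) + sum (map (rowCount G') (allFin n))
    ≡⟨ cong (sum (map (bit ∘ adj G) first) +_) (trans (edgeCount-slots G') (cong sum (map-∘ (slots n)))) ⟩
  sum (map (bit ∘ adj G) first) + sum (map (bit ∘ adj G) (map shift (slots n)))
    ≡⟨ sym (sum-++ (map (bit ∘ adj G) first) _) ⟩
  sum (map (bit ∘ adj G) first ++ map (bit ∘ adj G) (map shift (slots n)))
    ≡⟨ cong sum (sym (map-++ (bit ∘ adj G) first (map shift (slots n)))) ⟩
  count (adj G) (slots (suc n)) ∎
  where
  open ≡-Reasoning
  first : List (Pair (suc n))
  first = map (λ j → zero , suc j) (allFin n)
  G' : Graph n
  G' i j = G (suc i) (suc j)
  first-row : rowCount G zero ≡ sum (map (bit ∘ adj G) first)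
  first-row = trans (cong sum (map-allFin-suc {n = n} (λ j → if ⌊ zero {n} <? j ⌋ ∧ G zero j then 1 else 0)))
                    (cong sum (map-∘ (allFin n)))
  later-row : ∀ i → rowCount G (suc i) ≡ rowCount G' i
  later-row i = trans (cong sum (map-allFin-suc (λ j → if ⌊ suc i <? j ⌋ ∧ G (suc i) j then 1 else 0)))
    (cong sum (map-cong-local {xs = allFin n} (All.tabulate (λ {j} _ →
      cong (λ b → if b ∧ G (suc i) (suc j) then 1 else 0) (<?-suc i j)))))

edgeCount-encode : ∀ {n} (G : Graph n) → edgeCount G ≡ weight (encode G)
edgeCount-encode {n} G = trans (edgeCount-slots G) (cong sum (map-∘ (slots n)))

-- A labelling sends every vertex to the representative of its current component.
Labelling : ℕ → Set
Labelling n = Fin n → Fin n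

merge : ∀ {n} → Labelling n → Pair n → Labelling n
merge c (a , b) x = if ⌊ c x ≟ c b ⌋ then c a else c x

-- A marked code records for every slot whether it is a forest edge and whether it is present.
MCode : ℕ → Set
MCode n = List (Pair n × Bool × Bool)

present : ∀ {n} → MCode n → Code n
present = map (λ (p , _ , b) → p , b)

forestPart : ∀ {n} → MCode n → Code n
forestPart = map (λ (p , m , _) → p , m)

kruskal : ∀ {n} → Labelling n → Code n → MCode n
kruskal c [] = []
kruskal c ((p , false) ∷ z) = (p , false , false) ∷ kruskal c z
kruskal c ((p , true) ∷ z) with c (proj₁ p) ≟ c (proj₂ p)
... | yes _ = (p , false , true) ∷ kruskal c z
... | no _  = (p , true , true) ∷ kruskal (merge c p) z

components : ∀ {n} → Labelling n → Code n → Labelling n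
components c [] = c
components c ((p , false) ∷ z) = components c z
components c ((p , true) ∷ z) with c (proj₁ p) ≟ c (proj₂ p)
... | yes _ = components c z
... | no _  = components (merge c p) z

present-kruskal : ∀ {n} (c : Labelling n) (z : Code n) → present (kruskal c z) ≡ z
present-kruskal c [] = refl
present-kruskal c ((p , false) ∷ z) = cong ((p , false) ∷_) (present-kruskal c z)
present-kruskal c ((p , true) ∷ z) with c (proj₁ p) ≟ c (proj₂ p)
... | yes _ = cong ((p , true) ∷_) (present-kruskal c z)
... | no _  = cong ((p , true) ∷_) (present-kruskal (merge c p) z)

ForestPresent : ∀ {n} → Pair n × Bool × Bool → Set
ForestPresent (_ , m , b) = m ≡ true → b ≡ true

kruskal-forest-present : ∀ {n} (c : Labelling n) (z : Code n) → All ForestPresent (kruskal c z)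
kruskal-forest-present c [] = []
kruskal-forest-present c ((p , false) ∷ z) = (λ ()) ∷ kruskal-forest-present c z
kruskal-forest-present c ((p , true) ∷ z) with c (proj₁ p) ≟ c (proj₂ p)
... | yes _ = (λ _ → refl) ∷ kruskal-forest-present c z
... | no _  = (λ _ → refl) ∷ kruskal-forest-present (merge c p) z

keys-forestPart : ∀ {n} (s : MCode n) → keys (forestPart s) ≡ keys (present s)
keys-forestPart [] = refl
keys-forestPart ((p , _) ∷ s) = cong (p ∷_) (keys-forestPart s)

Pruned : ∀ {n} → Pair n × Bool × Bool → Pair n × Bool × Bool → Set
Pruned (p , m , b) (p' , m' , b') = p ≡ p' × m ≡ m' × (m ≡ true → b' ≡ b) × (b' ≡ true → b ≡ true)

kruskal-pruned : ∀ {n} (c : Labelling n) (z : Code n) {s : MCode n} →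
                 Pointwise Pruned (kruskal c z) s → kruskal c (present s) ≡ s
kruskal-pruned c [] [] = refl
kruskal-pruned c ((p , false) ∷ z) {(_ , _ , false) ∷ _} ((refl , refl , _ , _) ∷ pruned) =
  cong ((p , false , false) ∷_) (kruskal-pruned c z pruned)
kruskal-pruned c ((p , false) ∷ z) {(_ , _ , true) ∷ _} ((refl , refl , _ , b'⇒b) ∷ pruned)
  with () ← b'⇒b refl
kruskal-pruned c ((p , true) ∷ z) pruned with c (proj₁ p) ≟ c (proj₂ p) in joined
kruskal-pruned c ((p , true) ∷ z) {(_ , _ , false) ∷ _} ((refl , refl , _) ∷ pruned) | yes _ =
  cong ((p , false , false) ∷_) (kruskal-pruned c z pruned)
kruskal-pruned c ((p , true) ∷ z) {(_ , _ , true) ∷ _} ((refl , refl , _) ∷ pruned) | yes _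
  rewrite joined = cong ((p , false , true) ∷_) (kruskal-pruned c z pruned)
kruskal-pruned c ((p , true) ∷ z) {(_ , _ , b') ∷ _} ((refl , refl , kept , _) ∷ pruned) | no _
  with refl ← kept refl rewrite joined = cong ((p , true , true) ∷_) (kruskal-pruned (merge c p) z pruned)

Idempotent : ∀ {n} → Labelling n → Set
Idempotent {n} c = (x : Fin n) → c (c x) ≡ c x

roots : ∀ {n} → Labelling n → ℕ
roots {n} c = count (λ x → ⌊ c x ≟ x ⌋) (allFin n)

roots≤n : ∀ {n} (c : Labelling n) → roots c ≤ n
roots≤n {n} c = ≤-trans (count≤length _ (allFin n)) (≤-reflexive (length-tabulate id))

merge-idempotent : ∀ {n} (c : Labelling n) {a b : Fin n} → Idempotent c → c a ≢ c b → Idempotent (merge c (a , b))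
merge-idempotent c {a} {b} idem ca≢cb x with c x ≟ c b
... | yes _  rewrite idem a | ⌊⌋-false (c a ≟ c b) ca≢cb = refl
... | no cx≢cb rewrite idem x | ⌊⌋-false (c x ≟ c b) cx≢cb = refl

merge-root : ∀ {n} (c : Labelling n) {a b : Fin n} → Idempotent c → ∀ x → merge c (a , b) x ≡ x → c x ≡ x
merge-root c {a} {b} idem x fixed with c x ≟ c b
... | yes _ = trans (cong c (sym fixed)) (trans (idem a) fixed)
... | no _  = fixed

merge-fewer-roots : ∀ {n} (c : Labelling n) {a b : Fin n} → Idempotent c → c a ≢ c b →
                    roots (merge c (a , b)) < roots c
merge-fewer-roots c {a} {b} idem ca≢cb =
  count-strict (λ x root → ⌊⌋-true (c x ≟ x) (merge-root c idem x (⌊⌋-sound (merge c (a , b) x ≟ x) root)))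
               (∈-allFin (c b)) (⌊⌋-false (merge c (a , b) (c b) ≟ c b) moved) (⌊⌋-true (c (c b) ≟ c b) (idem b))
  where
  moved : merge c (a , b) (c b) ≢ c b
  moved with c (c b) ≟ c b
  ... | yes _     = ca≢cb
  ... | no ccb≢cb = λ _ → ccb≢cb (idem b)

forestSize : ∀ {n} → MCode n → ℕ
forestSize = count (proj₁ ∘ proj₂)

-- Each forest edge merges two components, so there are at most as many as initial components.
kruskal-size : ∀ {n} (c : Labelling n) (z : Code n) → Idempotent c → forestSize (kruskal c z) ≤ roots c
kruskal-size c [] idem = z≤n
kruskal-size c ((p , false) ∷ z) idem = kruskal-size c z idem
kruskal-size c (((a , b) , true) ∷ z) idem with c a ≟ c b
... | yes _ = kruskal-size c z idem
... | no ca≢cb = ≤-trans (s≤s (kruskal-size (merge c (a , b)) z (merge-idempotent c idem ca≢cb)))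
                         (merge-fewer-roots c idem ca≢cb)

merge-respects : ∀ {n} (c : Labelling n) (p : Pair n) {x y} → c x ≡ c y → merge c p x ≡ merge c p y
merge-respects c (a , b) cx≡cy rewrite cx≡cy = refl

components-respects : ∀ {n} (c : Labelling n) (z : Code n) {x y} → c x ≡ c y → components c z x ≡ components c z y
components-respects c [] same = same
components-respects c ((p , false) ∷ z) same = components-respects c z same
components-respects c ((p , true) ∷ z) same with c (proj₁ p) ≟ c (proj₂ p)
... | yes _ = components-respects c z same
... | no _  = components-respects (merge c p) z (merge-respects c p same)

Joins : ∀ {n} → Labelling n → Pair n × Bool → Set
Joins c ((a , b) , on) = on ≡ true → c a ≡ c b

components-joins : ∀ {n} (c : Labelling n) (z : Code n) → All (Joins (components c z)) z
components-joins c [] = []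
components-joins c ((p , false) ∷ z) = (λ ()) ∷ components-joins c z
components-joins c (((a , b) , true) ∷ z) with c a ≟ c b
... | yes ca≡cb = (λ _ → components-respects c z ca≡cb) ∷ components-joins c z
... | no ca≢cb  = (λ _ → components-respects (merge c (a , b)) z merged) ∷ components-joins (merge c (a , b)) z
  where
  merged : merge c (a , b) a ≡ merge c (a , b) b
  merged rewrite ⌊⌋-false (c a ≟ c b) ca≢cb | ⌊⌋-true (c b ≟ c b) refl = refl

InForest : ∀ {n} → Graph n → Pair n × Bool × Bool → Set
InForest T ((a , b) , m , _) = m ≡ true → T a b ≡ true

kruskal-walk : ∀ {n} (T : Graph n) → (∀ i j → T i j ≡ T j i) → (c : Labelling n) (z : Code n) →
               All (InForest T) (kruskal c z) → (∀ x y → c x ≡ c y → Walk T x y) →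
               ∀ x y → components c z x ≡ components c z y → Walk T x y
kruskal-walk T T-sym c [] [] joined = joined
kruskal-walk T T-sym c ((p , false) ∷ z) (_ ∷ forest) joined = kruskal-walk T T-sym c z forest joined
kruskal-walk T T-sym c (((a , b) , true) ∷ z) forest joined with c a ≟ c b
kruskal-walk T T-sym c (((a , b) , true) ∷ z) (_ ∷ forest) joined | yes _ =
  kruskal-walk T T-sym c z forest joined
kruskal-walk T T-sym c (((a , b) , true) ∷ z) (ab∈T ∷ forest) joined | no _ =
  kruskal-walk T T-sym (merge c (a , b)) z forest merged-joined
  where
  a→b : Walk T a b
  a→b = step (ab∈T refl) here
  b→a : Walk T b a
  b→a = step (trans (T-sym b a) (ab∈T refl)) here
  merged-joined : ∀ x y → merge c (a , b) x ≡ merge c (a , b) y → Walk T x y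
  merged-joined x y same with c x ≟ c b | c y ≟ c b
  ... | yes cx≡cb | yes cy≡cb = joined x y (trans cx≡cb (sym cy≡cb))
  ... | no _      | no _      = joined x y same
  ... | yes cx≡cb | no _      = joined x b cx≡cb ▸ (b→a ▸ joined a y same)
  ... | no _      | yes cy≡cb = joined x a same ▸ (a→b ▸ joined b y (sym cy≡cb))

pruned-keys : ∀ {n} {s s' : MCode n} → Pointwise Pruned s s' → keys (present s') ≡ keys (present s)
pruned-keys [] = refl
pruned-keys ((refl , _) ∷ pruned) = cong (_ ∷_) (pruned-keys pruned)

pruned-present : ∀ {n} {s s' : MCode n} → Pointwise Pruned s s' → Pointwise _⊑_ (present s') (present s)
pruned-present [] = []
pruned-present ((refl , _ , _ , b'⇒b) ∷ pruned) = (refl , b'⇒b) ∷ pruned-present pruned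

pruned-forest : ∀ {n} {s s' : MCode n} → All ForestPresent s → Pointwise Pruned s s' →
                Pointwise _⊑_ (forestPart s) (present s')
pruned-forest [] [] = []
pruned-forest (m⇒b ∷ forest) ((refl , refl , kept , _) ∷ pruned) =
  (refl , (λ m → trans (kept m) (m⇒b m))) ∷ pruned-forest forest pruned

-- Read the non-forest entries as brackets: an absent edge opens, a present edge closes.
-- unmatched j s: with j brackets open, s contains a present edge closing none of them.
unmatched : ∀ {n} → ℕ → MCode n → Bool
unmatched j [] = false
unmatched j ((p , true , b) ∷ s) = unmatched j s
unmatched j ((p , false , false) ∷ s) = unmatched (suc j) s
unmatched zero ((p , false , true) ∷ s) = true
unmatched (suc j) ((p , false , true) ∷ s) = unmatched j s

-- Delete the last unmatched present non-forest edge.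
lower : ∀ {n} → ℕ → MCode n → MCode n
lower j [] = []
lower j ((p , true , b) ∷ s) = (p , true , b) ∷ lower j s
lower j ((p , false , false) ∷ s) = (p , false , false) ∷ lower (suc j) s
lower zero ((p , false , true) ∷ s) with unmatched zero s
... | true  = (p , false , true) ∷ lower zero s
... | false = (p , false , false) ∷ s
lower (suc j) ((p , false , true) ∷ s) = (p , false , true) ∷ lower j s

-- Insert the first absent non-forest edge after which no present edge is unmatched.
raise : ∀ {n} → MCode n → MCode n
raise [] = []
raise ((p , true , b) ∷ s) = (p , true , b) ∷ raise s
raise ((p , false , true) ∷ s) = (p , false , true) ∷ raise s
raise ((p , false , false) ∷ s) with unmatched zero s
... | true  = (p , false , false) ∷ raise s
... | false = (p , false , true) ∷ s

unmatched-lower : ∀ {n} (j : ℕ) (s : MCode n) → unmatched j s ≡ true →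
                  ∀ i → i < j → unmatched i (lower j s) ≡ true
unmatched-lower j ((p , true , b) ∷ s) u i i<j = unmatched-lower j s u i i<j
unmatched-lower j ((p , false , false) ∷ s) u i i<j = unmatched-lower (suc j) s u (suc i) (s≤s i<j)
unmatched-lower (suc j) ((p , false , true) ∷ s) u zero i<j = refl
unmatched-lower (suc j) ((p , false , true) ∷ s) u (suc i) (s≤s i<j) = unmatched-lower j s u i i<j

raise-lower : ∀ {n} (j : ℕ) (s : MCode n) → unmatched j s ≡ true → raise (lower j s) ≡ s
raise-lower j ((p , true , b) ∷ s) u = cong ((p , true , b) ∷_) (raise-lower j s u)
raise-lower zero ((p , false , true) ∷ s) u with unmatched zero s in u'
... | true  = cong ((p , false , true) ∷_) (raise-lower zero s u')
... | false rewrite u' = refl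
raise-lower (suc j) ((p , false , true) ∷ s) u = cong ((p , false , true) ∷_) (raise-lower j s u)
raise-lower j ((p , false , false) ∷ s) u rewrite unmatched-lower (suc j) s u zero (s≤s z≤n) =
  cong ((p , false , false) ∷_) (raise-lower (suc j) s u)

Pruned-refl : ∀ {n} (s : MCode n) → Pointwise Pruned s s
Pruned-refl [] = []
Pruned-refl (_ ∷ s) = (refl , refl , (λ _ → refl) , (λ b → b)) ∷ Pruned-refl s

lower-pruned : ∀ {n} (j : ℕ) (s : MCode n) → Pointwise Pruned s (lower j s)
lower-pruned j [] = []
lower-pruned j ((p , true , b) ∷ s) = (refl , refl , (λ _ → refl) , (λ b → b)) ∷ lower-pruned j s
lower-pruned j ((p , false , false) ∷ s) = (refl , refl , (λ ()) , (λ b → b)) ∷ lower-pruned (suc j) s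
lower-pruned zero ((p , false , true) ∷ s) with unmatched zero s
... | true  = (refl , refl , (λ ()) , (λ b → b)) ∷ lower-pruned zero s
... | false = (refl , refl , (λ ()) , (λ ())) ∷ Pruned-refl s
lower-pruned (suc j) ((p , false , true) ∷ s) = (refl , refl , (λ ()) , (λ b → b)) ∷ lower-pruned j s

weight-lower : ∀ {n} (j : ℕ) (s : MCode n) → unmatched j s ≡ true →
               suc (weight (present (lower j s))) ≡ weight (present s)
weight-lower j ((p , true , b) ∷ s) u = trans (sym (+-suc (bit b) _)) (cong (bit b +_) (weight-lower j s u))
weight-lower zero ((p , false , true) ∷ s) u with unmatched zero s in u'
... | true  = cong suc (weight-lower zero s u')
... | false = refl
weight-lower (suc j) ((p , false , true) ∷ s) u = cong suc (weight-lower j s u)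
weight-lower j ((p , false , false) ∷ s) u = weight-lower (suc j) s u

freeOnes : ∀ {n} → MCode n → ℕ
freeOnes [] = 0
freeOnes ((p , true , b) ∷ s) = freeOnes s
freeOnes ((p , false , b) ∷ s) = bit b + freeOnes s

freeZeros : ∀ {n} → MCode n → ℕ
freeZeros [] = 0
freeZeros ((p , true , b) ∷ s) = freeZeros s
freeZeros ((p , false , b) ∷ s) = bit (not b) + freeZeros s

-- Without an unmatched edge, every present non-forest edge closes a bracket.
matched-bound : ∀ {n} (j : ℕ) (s : MCode n) → unmatched j s ≡ false → freeOnes s ≤ j + freeZeros s
matched-bound j [] _ = z≤n
matched-bound j ((p , true , b) ∷ s) m = matched-bound j s m
matched-bound (suc j) ((p , false , true) ∷ s) m = s≤s (matched-bound j s m)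
matched-bound j ((p , false , false) ∷ s) m = ≤-trans (matched-bound (suc j) s m) (≤-reflexive (sym (+-suc j _)))

weight-split : ∀ {n} (s : MCode n) → All ForestPresent s → freeOnes s + forestSize s ≡ weight (present s)
weight-split [] [] = refl
weight-split ((p , true , b) ∷ s) (m⇒b ∷ forest) rewrite m⇒b refl =
  trans (+-suc (freeOnes s) (forestSize s)) (cong suc (weight-split s forest))
weight-split ((p , false , b) ∷ s) (_ ∷ forest) =
  trans (+-assoc (bit b) (freeOnes s) (forestSize s)) (cong (bit b +_) (weight-split s forest))

length-split : ∀ {n} (s : MCode n) → freeOnes s + freeZeros s + forestSize s ≡ length s
length-split [] = refl
length-split ((p , true , b) ∷ s) = trans (+-suc (freeOnes s + freeZeros s) (forestSize s)) (cong suc (length-split s))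
length-split ((p , false , true) ∷ s) = cong suc (length-split s)
length-split ((p , false , false) ∷ s) =
  trans (cong (_+ forestSize s) (+-suc (freeOnes s) (freeZeros s))) (cong suc (length-split s))

regroup : ∀ a z f → (z + f) + (a + f) ≡ (a + z + f) + f
regroup = solve-∀

regroup′ : ∀ M n → (M + M) + n + n ≡ (M + n) + (M + n)
regroup′ = solve-∀

-- If a present and z absent non-forest edges and f ≤ n forest edges fill at most 2M slots
-- while a + f = k + 1 > M + n, then the present ones outnumber the absent ones.
crowded : ∀ {a z f k M n} → a + f ≡ suc k → a + z + f ≤ M + M → f ≤ n → M + n ≤ k → a ≤ z → ⊥
crowded {a} {z} {f} {k} {M} {n} a+f≡ slots≤ f≤n M+n≤k a≤z = <⇒≱ (+-mono-< (n<1+n k) (n<1+n k)) (begin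
  suc k + suc k        ≡⟨ cong₂ _+_ (sym a+f≡) (sym a+f≡) ⟩
  (a + f) + (a + f)    ≤⟨ +-monoˡ-≤ (a + f) (+-monoˡ-≤ f a≤z) ⟩
  (z + f) + (a + f)    ≡⟨ regroup a z f ⟩
  (a + z + f) + f      ≤⟨ +-mono-≤ slots≤ f≤n ⟩
  (M + M) + n          ≤⟨ m≤m+n _ n ⟩
  (M + M) + n + n      ≡⟨ regroup′ M n ⟩
  (M + n) + (M + n)    ≤⟨ +-mono-≤ M+n≤k M+n≤k ⟩
  k + k                ∎)
  where open ≤-Reasoning

marks : ∀ {n} → Graph n → MCode n
marks G = kruskal id (encode G)

lowered : ∀ {n} → Graph n → MCode n
lowered G = lower 0 (marks G)

down : ∀ {n} → Graph n → Graph n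
down G = decode (present (lowered G))

present-marks : ∀ {n} (G : Graph n) → present (marks G) ≡ encode G
present-marks G = present-kruskal id (encode G)

keys-lowered : ∀ {n} (G : Graph n) → keys (present (lowered G)) ≡ slots n
keys-lowered G = trans (pruned-keys (lower-pruned 0 (marks G))) (trans (cong keys (present-marks G)) (keys-encode G))

encode-down : ∀ {n} (G : Graph n) → encode (down G) ≡ present (lowered G)
encode-down G = encode-decode _ (keys-lowered G)

m≤⌈m/2⌉+⌈m/2⌉ : ∀ m → m ≤ ⌈ m /2⌉ + ⌈ m /2⌉
m≤⌈m/2⌉+⌈m/2⌉ m = ≤-trans (≤-reflexive (sym (⌊n/2⌋+⌈n/2⌉≡n m))) (+-monoˡ-≤ ⌈ m /2⌉ (⌊n/2⌋≤⌈n/2⌉ m))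

unmatched-marks : ∀ {n k} → ⌈ (n C 2) /2⌉ + n ≤ k → (G : Graph n) → edgeCount G ≡ suc k →
                  unmatched 0 (marks G) ≡ true
unmatched-marks {n} {k} hk G edges with unmatched 0 (marks G) in u
... | true  = refl
... | false = ⊥-elim (crowded present-split slots-bound forest-bound hk (matched-bound 0 (marks G) u))
  where
  present-split : freeOnes (marks G) + forestSize (marks G) ≡ suc k
  present-split = begin
    freeOnes (marks G) + forestSize (marks G) ≡⟨ weight-split (marks G) (kruskal-forest-present id (encode G)) ⟩
    weight (present (marks G))                ≡⟨ cong weight (present-marks G) ⟩
    weight (encode G)                         ≡⟨ sym (edgeCount-encode G) ⟩
    edgeCount G                               ≡⟨ edges ⟩
    suc k                                     ∎
    where open ≡-Reasoning
  slots-bound : freeOnes (marks G) + freeZeros (marks G) + forestSize (marks G) ≤ ⌈ (n C 2) /2⌉ + ⌈ (n C 2) /2⌉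
  slots-bound = ≤-trans (≤-reflexive (begin
    freeOnes (marks G) + freeZeros (marks G) + forestSize (marks G) ≡⟨ length-split (marks G) ⟩
    length (marks G)            ≡⟨ sym (length-map _ (marks G)) ⟩
    length (present (marks G))  ≡⟨ cong length (present-marks G) ⟩
    length (encode G)           ≡⟨ length-map _ (slots n) ⟩
    length (slots n)            ≡⟨ length-slots n ⟩
    n C 2                       ∎)) (m≤⌈m/2⌉+⌈m/2⌉ (n C 2))
    where open ≡-Reasoning
  forest-bound : forestSize (marks G) ≤ n
  forest-bound = ≤-trans (kruskal-size id (encode G) (λ _ → refl)) (roots≤n id)

down-edgeCount : ∀ {n} (G : Graph n) → unmatched 0 (marks G) ≡ true → suc (edgeCount (down G)) ≡ edgeCount G
down-edgeCount G u = begin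
  suc (edgeCount (down G))           ≡⟨ cong suc (trans (edgeCount-encode (down G)) (cong weight (encode-down G))) ⟩
  suc (weight (present (lowered G))) ≡⟨ weight-lower 0 (marks G) u ⟩
  weight (present (marks G))         ≡⟨ cong weight (present-marks G) ⟩
  weight (encode G)                  ≡⟨ sym (edgeCount-encode G) ⟩
  edgeCount G                        ∎
  where open ≡-Reasoning

down-simple : ∀ {n} (G : Graph n) → IsSimple (down G)
down-simple G = decode-simple _ (keys-lowered G)

down-⊆ : ∀ {n} (G : Graph n) → IsSimple G → down G ⊆G G
down-⊆ G simple i j edge =
  trans (decode-encode G simple i j)
        (subst (λ z → decode z i j ≡ true) (present-marks G)
               (decode-mono (pruned-present (lower-pruned 0 (marks G))) i j edge))

forestOf : ∀ {n} → Graph n → Graph n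
forestOf G = decode (forestPart (marks G))

forest-complete : ∀ {n} (G : Graph n) → All (InForest (forestOf G)) (marks G)
forest-complete G = All.map (λ looked-up marked → trans looked-up marked)
  (map⁻ (decode-lookup (forestPart (marks G)) (apart-keys keys-forest)))
  where
  keys-forest : keys (forestPart (marks G)) ≡ slots _
  keys-forest = trans (keys-forestPart (marks G)) (trans (cong keys (present-marks G)) (keys-encode G))

edge-joins : ∀ {n} (G : Graph n) → IsSimple G → ∀ a b → G a b ≡ true →
             components id (encode G) a ≡ components id (encode G) b
edge-joins G (G-sym , _) = slots-suffice
  (λ joins Gba → sym (joins (trans (G-sym _ _) Gba)))
  (λ _ _ → refl)
  (All.lookup (map⁻ (components-joins id (encode G))))

same-component : ∀ {n} (G : Graph n) → IsSimple G → ∀ {x y} → Walk G x y →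
                 components id (encode G) x ≡ components id (encode G) y
same-component G simple here = refl
same-component G simple (step e w) = trans (edge-joins G simple _ _ e) (same-component G simple w)

-- The forest survives lowering and joins everything G joins.
down-connected : ∀ {n} (G : Graph n) → IsSimple G → Connected G → Connected (down G)
down-connected G simple connected x y =
  walk-mono forest⊆down
    (kruskal-walk (forestOf G) (decode-symmetric (forestPart (marks G))) id (encode G) (forest-complete G)
                  (λ x y x≡y → subst (Walk _ x) x≡y here) x y (same-component G simple (connected x y)))
  where
  forest⊆down : forestOf G ⊆G down G
  forest⊆down = decode-mono (pruned-forest (kruskal-forest-present id (encode G)) (lower-pruned 0 (marks G)))

encode-cong : ∀ {n} {G H : Graph n} → G ≈G H → encode G ≡ encode H
encode-cong {n} G≈H = map-cong (λ (i , j) → cong ((i , j) ,_) (G≈H i j)) (slots n)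

-- Since lowering only deletes a non-forest edge, G is recovered from down G.
encode-from-down : ∀ {n} (G : Graph n) → unmatched 0 (marks G) ≡ true →
                   encode G ≡ present (raise (kruskal id (encode (down G))))
encode-from-down G u = begin
  encode G
    ≡⟨ sym (present-marks G) ⟩
  present (marks G)
    ≡⟨ cong present (sym (raise-lower 0 (marks G) u)) ⟩
  present (raise (lowered G))
    ≡⟨ cong (present ∘ raise) (sym (kruskal-pruned id (encode G) (lower-pruned 0 (marks G)))) ⟩
  present (raise (kruskal id (present (lowered G))))
    ≡⟨ cong (present ∘ raise ∘ kruskal id) (sym (encode-down G)) ⟩
  present (raise (kruskal id (encode (down G)))) ∎
  where open ≡-Reasoning

down-injective : ∀ {n} (G H : Graph n) → IsSimple G → IsSimple H →
                 unmatched 0 (marks G) ≡ true → unmatched 0 (marks H) ≡ true → down G ≈G down H → G ≈G H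
down-injective G H simple-G simple-H u-G u-H down≈ i j = begin
  G i j                   ≡⟨ decode-encode G simple-G i j ⟩
  decode (encode G) i j   ≡⟨ cong (λ z → decode z i j) encode≡ ⟩
  decode (encode H) i j   ≡⟨ sym (decode-encode H simple-H i j) ⟩
  H i j                   ∎
  where
  open ≡-Reasoning
  encode≡ : encode G ≡ encode H
  encode≡ = trans (encode-from-down G u-G)
                  (trans (cong (present ∘ raise ∘ kruskal id) (encode-cong down≈)) (sym (encode-from-down H u-H)))

down-cong : ∀ {n} {G H : Graph n} → G ≈G H → down G ≈G down H
down-cong G≈H i j = cong (λ z → decode (present (lower 0 (kruskal id z))) i j) (encode-cong G≈H)

lemma3p3 : ∀ (n : ℕ) → 1 ≤ n → ∀ (k : ℕ) → ⌈ (n C 2) /2⌉ + n ≤ k → k ≤ n C 2 →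
           CompleteMatching n (suc k) k
lemma3p3 n _ k many-edges _ =
    downMap
  , (λ _ _ → down-cong)
  , (λ (G , simple-G , _ , edges-G) (H , simple-H , _ , edges-H) →
       down-injective G H simple-G simple-H (unmatched-marks many-edges G edges-G) (unmatched-marks many-edges H edges-H))
  , (λ (G , simple , _) → inj₂ (down-⊆ G simple))
  where
  downMap : ConnGraphs n (suc k) → ConnGraphs n k
  downMap (G , simple , connected , edges) =
      down G , down-simple G , down-connected G simple connected
    , suc-injective (trans (down-edgeCount G (unmatched-marks many-edges G edges)) edges)
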